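{- Let $k\ge 2$, $n\ge 0$, and let $p$ be a prime. Then $$a_{1,k}(n)=\sum_{i\ge 1}\binom{i-1}{k-1}\mathfrak p(n-i)\quad\text{and}\quad a_{p,k}(n)=\sum_{i,j\ge 1}\binom{i-1}{k-2}\mathfrak p(n-i-pj).$$
   Context: A partition of $n$ is a weakly decreasing finite sequence of positive integers summing to $n$; $\mathcal P(n)$ is the set of partitions of $n$, and $\mathfrak p(n)=|\mathcal P(n)|$, with $\mathfrak p(0)=1$ and $\mathfrak p(m)=0$ for $m<0$. For a partition $\lambda$ and positive integer $i$, $m_\lambda(i)$ is the number of parts equal to $i$. For $\lambda=(\lambda_1,\ldots,\lambda_\ell)$ with $\ell\ge k$, $\mathrm{pre}_k(\lambda)$ is the partition whose parts are the $\binom{\ell}{k}$ products $\lambda_{i_1}\cdots\lambda_{i_k}$ over all $1\le i_1<\cdots<i_k\le\ell$ (with multiplicity); it is undefined if $\ell<k$. $\mathrm{pre}_k(\mathcal P(n))$ is the set of $\mathrm{pre}_k(\lambda)$ for $\lambda\in\mathcal P(n)$ with at least $k$ parts, and $a_{i,k}(n)=\sum_{\nu\in\mathrm{pre}_k(\mathcal P(n))} m_\nu(i)$. -}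

module Defs where

open import Data.Nat using (ℕ; zero; suc; _+_; _*_; _∸_; _≤ᵇ_; _≡ᵇ_)
open import Data.Nat.Properties using (_≟_)
open import Data.Bool using (Bool; true; false; _∧_; if_then_else_)
open import Data.List using (List; []; _∷_; map; concatMap; _++_; length; filter; deduplicate; filterᵇ; applyUpTo)
open import Data.List.Properties using (≡-dec)
open import Data.Nat.ListAction using (sum; product)

decreasingᵇ : List ℕ → Bool
decreasingᵇ []           = true
decreasingᵇ (x ∷ [])     = true
decreasingᵇ (x ∷ y ∷ xs) = (y ≤ᵇ x) ∧ decreasingᵇ (y ∷ xs)

positiveᵇ : List ℕ → Bool
positiveᵇ []       = true
positiveᵇ (x ∷ xs) = (1 ≤ᵇ x) ∧ positiveᵇ xs

isPartitionᵇ : ℕ → List ℕ → Bool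
isPartitionᵇ n xs = decreasingᵇ xs ∧ positiveᵇ xs ∧ (sum xs ≡ᵇ n)

words : ℕ → ℕ → List (List ℕ)
words m zero    = [] ∷ []
words m (suc l) = concatMap (λ x → map (x ∷_) (words m l)) (applyUpTo (λ i → i) (suc m))

wordsUpTo : ℕ → ℕ → List (List ℕ)
wordsUpTo m zero    = words m zero
wordsUpTo m (suc l) = wordsUpTo m l ++ words m (suc l)

-- 𝒫(n): every partition of n has at most n parts, each ≤ n; listed once each
𝒫 : ℕ → List (List ℕ)
𝒫 n = filterᵇ (isPartitionᵇ n) (wordsUpTo n n)

-- 𝔭(n) = |𝒫(n)|  (𝔭(0) = 1 since 𝒫(0) = [ [] ])
𝔭 : ℕ → ℕ
𝔭 n = length (𝒫 n)

-- all k-element sub-multisets by index positions i₁ < … < i_k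
choose : ℕ → List ℕ → List (List ℕ)
choose zero    xs       = [] ∷ []
choose (suc k) []       = []
choose (suc k) (x ∷ xs) = map (x ∷_) (choose k xs) ++ choose (suc k) xs

insert : ℕ → List ℕ → List ℕ
insert x []       = x ∷ []
insert x (y ∷ ys) = if y ≤ᵇ x then x ∷ y ∷ ys else y ∷ insert x ys

sortDesc : List ℕ → List ℕ
sortDesc []       = []
sortDesc (x ∷ xs) = insert x (sortDesc xs)

-- pre_k(λ): the partition whose parts are the products over all k-subsets of
-- indices (with multiplicity), written in weakly decreasing order.
-- Only meaningful when length λ ≥ k (see preSet).
pre : ℕ → List ℕ → List ℕ
pre k λs = sortDesc (map product (choose k λs))

-- pre_k(𝒫(n)) as a SET: pre_k(λ) for λ ∈ 𝒫(n) with ≥ k parts, duplicates removed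
preSet : ℕ → ℕ → List (List ℕ)
preSet k n = deduplicate (≡-dec _≟_)
               (map (pre k) (filterᵇ (λ λs → k ≤ᵇ length λs) (𝒫 n)))

mult : List ℕ → ℕ → ℕ
mult ν i = length (filterᵇ (λ x → x ≡ᵇ i) ν)

a : ℕ → ℕ → ℕ → ℕ
a i k n = sum (map (λ ν → mult ν i) (preSet k n))

-- 𝔭 extended by 0 to negative arguments: 𝔭⁻ n s = 𝔭(n - s)  (0 if s > n)
𝔭- : ℕ → ℕ → ℕ
𝔭- n s = if s ≤ᵇ n then 𝔭 (n ∸ s) else 0

Σ[1‥_] : ℕ → (ℕ → ℕ) → ℕ
Σ[1‥ N ] f = sum (applyUpTo (λ i → f (suc i)) N)

-- The multiplicity of x in pre_k λ is the number of k-subsets of the parts of λ with product x. A subset with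
-- product 1 consists of ones, and one with product a prime p of a single part p and k - 1 ones, so the
-- multiplicities of 1 and p in pre_k λ are C(m₁, k) and m_p C(m₁, k - 1), where m_t = m_λ(t). Both vanish unless
-- m₁ ≥ k - 1, and then pre_k λ determines λ: the multiplicity of u in pre_k λ is m_u C(m₁, k - 1) plus a count
-- depending only on the parts of λ below u, so m₁, m₂, m₃, … can be recovered one after the other. Hence
-- a_{q,k}(n), for q ∈ {1, p}, is the sum of these multiplicities over all λ ∈ 𝒫(n). Writing C(m₁, k) as
-- Σ_{i ≤ m₁} C(i - 1, k - 1) and m_p as Σ_{j ≤ m_p} 1 and exchanging sums leaves the number of partitions of n
-- with at least i ones and at least j parts p, which is 𝔭(n - i - pj) since removing those parts is a bijection.

module Submission where

open import Data.Bool using (Bool; true; false; T; T?; _∧_)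
open import Data.Bool.Properties using (T-∧)
open import Data.Empty using (⊥-elim)
open import Data.List
  using (List; []; _∷_; [_]; _++_; map; length; filter; filterᵇ; replicate; applyUpTo; concatMap; cartesianProductWith; deduplicate)
open import Data.List.Properties
  using ( ≡-dec; ∷-injective; ∷-injectiveˡ; ∷-injectiveʳ; length-map; length-++; map-++; map-∘; map-cong; map-cong-local
        ; filter-++; filter-accept; filter-reject; filter-all; filter-none)
open import Data.List.Membership.Propositional using (_∈_)
open import Data.List.Membership.Propositional.Properties
  using ( ∈-map⁺; ∈-map⁻; ∈-∃++; ∈-++⁺ˡ; ∈-++⁺ʳ; ∈-++⁻; ∈-applyUpTo⁺; ∈-filter⁺; ∈-filter⁻; ∈-deduplicate⁻
        ; ∈-cartesianProductWith⁺; ∈-cartesianProductWith⁻)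
open import Data.List.Membership.Propositional.Properties.WithK using (unique∧set⇒bag)
open import Data.List.Relation.Binary.BagAndSetEquality using (∼bag⇒↭)
open import Data.List.Relation.Binary.Permutation.Propositional
  using (_↭_; ↭-refl; ↭-prep; ↭-swap; ↭-trans; ↭-sym; ↭⇒↭ₛ; module PermutationReasoning)
open import Data.List.Relation.Binary.Permutation.Propositional.Properties using (↭-length; filter-↭; shift; All-resp-↭)
open import Data.List.Relation.Binary.Pointwise using (Pointwise-≡⇒≡)
open import Data.List.Relation.Unary.All as All using (All; []; _∷_)
import Data.List.Relation.Unary.All.Properties as All
open import Data.List.Relation.Unary.AllPairs using (AllPairs; []; _∷_)
import Data.List.Relation.Unary.AllPairs.Properties as AllPairs
open import Data.List.Relation.Unary.Any using (here; there)
open import Data.List.Relation.Unary.Linked using (Linked; []; [-]; _∷_)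
open import Data.List.Relation.Unary.Linked.Properties using (AllPairs⇒Linked; Linked⇒AllPairs)
open import Data.List.Relation.Unary.Sorted.TotalOrder.Properties using (↗↭↗⇒≋)
open import Data.List.Relation.Unary.Unique.Propositional using (Unique)
import Data.List.Relation.Unary.Unique.Propositional.Properties as Unique
open import Data.Nat
  using (ℕ; zero; suc; _+_; _*_; _∸_; _≤_; _<_; _≥_; _≤ᵇ_; _<ᵇ_; _≡ᵇ_; z≤n; s≤s; >-nonZero; >-nonZero⁻¹; nonTrivial⇒n>1)
open import Data.Nat.Combinatorics using (_C_; nCk+nC[k+1]≡[n+1]C[k+1])
open import Data.Nat.Divisibility using (_∣_; ∣-refl; ∣⇒≤)
open import Data.Nat.ListAction using (sum; product)
open import Data.Nat.ListAction.Properties using (sum-↭)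
open import Data.Nat.Primality using (Prime; euclidsLemma; prime⇒nonTrivial)
open import Data.Nat.Properties
open import Data.Product using (_×_; _,_; proj₁; proj₂; ∃)
open import Data.Sum using (inj₁; inj₂)
open import Function using (_∘_; Equivalence; mk⇔)
open import Level using (0ℓ)
open import Relation.Binary using (DecidableEquality; tri<; tri≈; tri>)
open import Relation.Binary.Properties.TotalOrder ≤-totalOrder using (≥-totalOrder)
open import Relation.Binary.PropositionalEquality hiding ([_])
open import Relation.Nullary using (¬_; ¬?; yes; no)
open import Relation.Nullary.Decidable using (decidable-stable)
open import Relation.Unary using (Pred; Decidable)
import Algebra.Properties.CommutativeSemigroup +-commutativeSemigroup as +-Semigroup

open import Defs

𝟙 : Bool → ℕ
𝟙 true  = 1
𝟙 false = 0

𝟙-≡ᵇ-≢ : ∀ {x y} → x ≢ y → 𝟙 (x ≡ᵇ y) ≡ 0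
𝟙-≡ᵇ-≢ {x} {y} x≢y with x ≡ᵇ y in eq
... | true  = ⊥-elim (x≢y (≡ᵇ⇒≡ x y (subst T (sym eq) _)))
... | false = refl

𝟙-≡ᵇ-refl : ∀ x → 𝟙 (x ≡ᵇ x) ≡ 1
𝟙-≡ᵇ-refl x with x ≡ᵇ x | ≡⇒≡ᵇ x x refl
... | true | _ = refl

𝟙-∧ : ∀ a b → 𝟙 (a ∧ b) ≡ 𝟙 a * 𝟙 b
𝟙-∧ true  b = sym (+-identityʳ (𝟙 b))
𝟙-∧ false b = refl

≤ᵇ-suc : ∀ m n → (suc m ≤ᵇ suc n) ≡ (m ≤ᵇ n)
≤ᵇ-suc zero    n = refl
≤ᵇ-suc (suc m) n = refl

≮ᵇ⇒≥ : ∀ {m n} → (m <ᵇ n) ≡ false → n ≤ m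
≮ᵇ⇒≥ m≮ᵇn = ≮⇒≥ λ m<n → subst T m≮ᵇn (<⇒<ᵇ m<n)

≰ᵇ⇒> : ∀ {m n} → (m ≤ᵇ n) ≡ false → n < m
≰ᵇ⇒> m≰ᵇn = ≰⇒> λ m≤n → subst T m≰ᵇn (≤⇒≤ᵇ m≤n)

prime⇒>1 : ∀ {p} → Prime p → 1 < p
prime⇒>1 {p} p-prime = nonTrivial⇒n>1 p {{prime⇒nonTrivial p-prime}}

C-≡0 : ∀ {n k} → n < k → n C k ≡ 0
C-≡0 {n} {k} n<k with k ≤ᵇ n in k≤ᵇn
... | true  = ⊥-elim (<⇒≱ n<k (≤ᵇ⇒≤ k n (subst T (sym k≤ᵇn) _)))
... | false = refl

C>0⇒≤ : ∀ {n k} → 0 < n C k → k ≤ n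
C>0⇒≤ {n} {k} nCk>0 = ≮⇒≥ λ n<k → <⇒≢ nCk>0 (sym (C-≡0 n<k))

≤⇒C>0 : ∀ {n k} → k ≤ n → 0 < n C k
≤⇒C>0 {n}     {zero}  _         = s≤s z≤n
≤⇒C>0 {suc n} {suc k} (s≤s k≤n) = <-≤-trans (≤⇒C>0 k≤n) (subst (n C k ≤_) (nCk+nC[k+1]≡[n+1]C[k+1] n k) (m≤m+n _ _))

C-suc-< : ∀ {j n} → j ≤ n → n C suc j < suc n C suc j
C-suc-< {j} {n} j≤n =
  subst (n C suc j <_) (trans (+-comm (n C suc j) (n C j)) (nCk+nC[k+1]≡[n+1]C[k+1] n j)) (m<m+n (n C suc j) (≤⇒C>0 j≤n))

C-strictMonoˡ : ∀ {j m n} → j ≤ m → m < n → m C suc j < n C suc j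
C-strictMonoˡ {j} {m} {suc n} j≤m (s≤s m≤n) with m≤n⇒m<n∨m≡n m≤n
... | inj₁ m<n  = <-trans (C-strictMonoˡ j≤m m<n) (C-suc-< (≤-trans j≤m m≤n))
... | inj₂ refl = C-suc-< j≤m

C-injectiveˡ : ∀ {j m n} → j ≤ m → j ≤ n → m C suc j ≡ n C suc j → m ≡ n
C-injectiveˡ {j} {m} {n} j≤m j≤n mCj≡nCj with <-cmp m n
... | tri< m<n _ _ = ⊥-elim (<⇒≢ (C-strictMonoˡ j≤m m<n) mCj≡nCj)
... | tri≈ _ m≡n _ = m≡n
... | tri> _ _ n<m = ⊥-elim (<⇒≢ (C-strictMonoˡ j≤n n<m) (sym mCj≡nCj))

Σ-cong : ∀ N {f g : ℕ → ℕ} → (∀ {i} → 1 ≤ i → f i ≡ g i) → Σ[1‥ N ] f ≡ Σ[1‥ N ] g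
Σ-cong zero    _   = refl
Σ-cong (suc N) f≗g = cong₂ _+_ (f≗g (s≤s z≤n)) (Σ-cong N (λ {i} _ → f≗g {suc i} (s≤s z≤n)))

Σ-zero : ∀ N → Σ[1‥ N ] (λ _ → 0) ≡ 0
Σ-zero zero    = refl
Σ-zero (suc N) = Σ-zero N

Σ-+ : ∀ N (f g : ℕ → ℕ) → Σ[1‥ N ] (λ i → f i + g i) ≡ Σ[1‥ N ] f + Σ[1‥ N ] g
Σ-+ zero    f g = refl
Σ-+ (suc N) f g = trans (cong (f 1 + g 1 +_) (Σ-+ N (f ∘ suc) (g ∘ suc)))
  (+-Semigroup.interchange (f 1) (g 1) (Σ[1‥ N ] (f ∘ suc)) (Σ[1‥ N ] (g ∘ suc)))

*-Σ : ∀ N c (f : ℕ → ℕ) → c * Σ[1‥ N ] f ≡ Σ[1‥ N ] (λ i → c * f i)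
*-Σ zero    c f = *-zeroʳ c
*-Σ (suc N) c f = trans (*-distribˡ-+ c (f 1) _) (cong (c * f 1 +_) (*-Σ N c (f ∘ suc)))

Σ-* : ∀ N c (f : ℕ → ℕ) → Σ[1‥ N ] f * c ≡ Σ[1‥ N ] (λ i → f i * c)
Σ-* N c f = trans (*-comm _ c) (trans (*-Σ N c f) (Σ-cong N (λ {i} _ → *-comm c (f i))))

Σ-snoc : ∀ N (f : ℕ → ℕ) → Σ[1‥ suc N ] f ≡ Σ[1‥ N ] f + f (suc N)
Σ-snoc zero    f = +-identityʳ (f 1)
Σ-snoc (suc N) f = trans (cong (f 1 +_) (Σ-snoc N (f ∘ suc))) (sym (+-assoc (f 1) _ _))

Σ-truncate : ∀ {m N} (f : ℕ → ℕ) → m ≤ N → Σ[1‥ N ] (λ i → f i * 𝟙 (i ≤ᵇ m)) ≡ Σ[1‥ m ] f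
Σ-truncate {zero}  {N}     f _ =
  trans (Σ-cong N {λ i → f i * 𝟙 (i ≤ᵇ 0)} {λ _ → 0} λ { {suc i} _ → *-zeroʳ (f (suc i)) }) (Σ-zero N)
Σ-truncate {suc m} {suc N} f (s≤s m≤N) = cong₂ _+_ (*-identityʳ (f 1))
  (trans (Σ-cong N (λ {i} _ → cong (λ b → f (suc i) * 𝟙 b) (≤ᵇ-suc i m))) (Σ-truncate (f ∘ suc) m≤N))

Σ-one : ∀ m → Σ[1‥ m ] (λ _ → 1) ≡ m
Σ-one zero    = refl
Σ-one (suc m) = cong suc (Σ-one m)

hockey-stick : ∀ m j → Σ[1‥ m ] (λ i → (i ∸ 1) C j) ≡ m C suc j
hockey-stick zero    j = refl
hockey-stick (suc m) j = begin
  Σ[1‥ suc m ] (λ i → (i ∸ 1) C j) ≡⟨ Σ-snoc m (λ i → (i ∸ 1) C j) ⟩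
  Σ[1‥ m ] (λ i → (i ∸ 1) C j) + m C j ≡⟨ cong (_+ m C j) (hockey-stick m j) ⟩
  m C suc j + m C j                  ≡⟨ +-comm (m C suc j) (m C j) ⟩
  m C j + m C suc j                  ≡⟨ nCk+nC[k+1]≡[n+1]C[k+1] m j ⟩
  suc m C suc j ∎
  where open ≡-Reasoning

C-as-Σ : ∀ {m} N j → m ≤ N → m C suc j ≡ Σ[1‥ N ] (λ i → ((i ∸ 1) C j) * 𝟙 (i ≤ᵇ m))
C-as-Σ {m} N j m≤N = sym (trans (Σ-truncate (λ i → (i ∸ 1) C j) m≤N) (hockey-stick m j))

n-as-Σ : ∀ {m} N → m ≤ N → m ≡ Σ[1‥ N ] (λ l → 𝟙 (l ≤ᵇ m))
n-as-Σ {m} N m≤N = sym (begin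
  Σ[1‥ N ] (λ l → 𝟙 (l ≤ᵇ m))     ≡⟨ Σ-cong N (λ {l} _ → sym (*-identityˡ (𝟙 (l ≤ᵇ m)))) ⟩
  Σ[1‥ N ] (λ l → 1 * 𝟙 (l ≤ᵇ m)) ≡⟨ Σ-truncate (λ _ → 1) m≤N ⟩
  Σ[1‥ m ] (λ _ → 1)              ≡⟨ Σ-one m ⟩
  m ∎)
  where open ≡-Reasoning

sum-map-Σ : ∀ {A : Set} N (F : A → ℕ → ℕ) xs →
  sum (map (λ x → Σ[1‥ N ] (F x)) xs) ≡ Σ[1‥ N ] (λ i → sum (map (λ x → F x i) xs))
sum-map-Σ N F []       = sym (Σ-zero N)
sum-map-Σ N F (x ∷ xs) = trans (cong (Σ[1‥ N ] (F x) +_) (sum-map-Σ N F xs)) (sym (Σ-+ N (F x) (λ i → sum (map (λ y → F y i) xs))))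

sum-map-𝟙 : ∀ {A : Set} c (q : A → Bool) xs → sum (map (λ x → c * 𝟙 (q x)) xs) ≡ c * length (filterᵇ q xs)
sum-map-𝟙 c q []       = sym (*-zeroʳ c)
sum-map-𝟙 c q (x ∷ xs) with q x
... | true  = trans (cong₂ _+_ (*-identityʳ c) (sum-map-𝟙 c q xs)) (sym (*-suc c _))
... | false = cong₂ _+_ (*-zeroʳ c) (sum-map-𝟙 c q xs)

sum-map-filter : ∀ {A : Set} (w : A → ℕ) {P : Pred A 0ℓ} (P? : Decidable P) xs →
  (∀ {x} → x ∈ xs → ¬ P x → w x ≡ 0) → sum (map w (filter P? xs)) ≡ sum (map w xs)
sum-map-filter w P? []       _        = refl
sum-map-filter w P? (x ∷ xs) dropped≡0 with P? x
... | yes _  = cong (w x +_) (sum-map-filter w P? xs (dropped≡0 ∘ there))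
... | no ¬px = trans (sum-map-filter w P? xs (dropped≡0 ∘ there)) (cong (_+ sum (map w xs)) (sym (dropped≡0 (here refl) ¬px)))

sum-map-deduplicate : ∀ {A : Set} (_≟ᴬ_ : DecidableEquality A) (w : A → ℕ) {xs} →
  AllPairs (λ x y → 0 < w x → x ≢ y) xs → sum (map w (deduplicate _≟ᴬ_ xs)) ≡ sum (map w xs)
sum-map-deduplicate _≟ᴬ_ w []                     = refl
sum-map-deduplicate _≟ᴬ_ w {x ∷ xs} (x≢xs ∷ xs!) =
  cong (w x +_) (trans (sum-map-filter w (¬? ∘ (x ≟ᴬ_)) (deduplicate _≟ᴬ_ xs) dropped≡0) (sum-map-deduplicate _≟ᴬ_ w xs!))
  where
  dropped≡0 : ∀ {y} → y ∈ deduplicate _≟ᴬ_ xs → ¬ ¬ x ≡ y → w y ≡ 0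
  dropped≡0 {y} y∈ ¬x≢y with decidable-stable (x ≟ᴬ y) ¬x≢y | w x in wx
  ... | refl | zero  = wx
  ... | refl | suc _ = ⊥-elim (All.lookup x≢xs (∈-deduplicate⁻ _≟ᴬ_ xs y∈) (s≤s z≤n) refl)

length-bijection : ∀ {A B : Set} (f : A → B) {xs ys} → Unique xs → Unique ys → (∀ {x y} → f x ≡ f y → x ≡ y) →
  (∀ {x} → x ∈ xs → f x ∈ ys) → (∀ {y} → y ∈ ys → ∃ λ x → x ∈ xs × f x ≡ y) → length xs ≡ length ys
length-bijection f {xs} {ys} xs! ys! f-injective to from = trans (sym (length-map f xs))
  (↭-length (∼bag⇒↭ (unique∧set⇒bag (Unique.map⁺ f-injective xs!) ys! (mk⇔ to′ from′))))
  where
  to′ : ∀ {y} → y ∈ map f xs → y ∈ ys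
  to′ y∈ with ∈-map⁻ f y∈
  ... | _ , x∈ , refl = to x∈
  from′ : ∀ {y} → y ∈ ys → y ∈ map f xs
  from′ y∈ with from y∈
  ... | _ , x∈ , refl = ∈-map⁺ f x∈

Positive : List ℕ → Set
Positive = All (1 ≤_)

mult-∷-≡ : ∀ t xs → mult (t ∷ xs) t ≡ suc (mult xs t)
mult-∷-≡ t xs = cong length (filter-accept (T? ∘ (_≡ᵇ t)) {t} {xs} (≡⇒≡ᵇ t t refl))

mult-∷-≢ : ∀ {x t} xs → x ≢ t → mult (x ∷ xs) t ≡ mult xs t
mult-∷-≢ {x} {t} xs x≢t = cong length (filter-reject (T? ∘ (_≡ᵇ t)) {x} {xs} (x≢t ∘ ≡ᵇ⇒≡ x t))

mult-singleton : ∀ y {t} → mult [ y ] t ≡ 𝟙 (y ≡ᵇ t)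
mult-singleton y {t} with y ≡ᵇ t
... | true  = refl
... | false = refl

mult-++ : ∀ xs ys t → mult (xs ++ ys) t ≡ mult xs t + mult ys t
mult-++ xs ys t = trans (cong length (filter-++ (T? ∘ (_≡ᵇ t)) xs ys)) (length-++ (filterᵇ (_≡ᵇ t) xs))

mult-↭ : ∀ {xs ys} t → xs ↭ ys → mult xs t ≡ mult ys t
mult-↭ t = ↭-length ∘ filter-↭ (T? ∘ (_≡ᵇ t))

mult-zero : ∀ {xs} → Positive xs → mult xs 0 ≡ 0
mult-zero xs>0 = cong length (filter-none (T? ∘ (_≡ᵇ 0)) (All.map (λ { (s≤s _) () }) xs>0))

mult>0⇒∈ : ∀ {t} xs → 0 < mult xs t → t ∈ xs
mult>0⇒∈ {t} xs m>0 with filterᵇ (_≡ᵇ t) xs in eq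
... | y ∷ _ with ∈-filter⁻ (T? ∘ (_≡ᵇ t)) {xs = xs} (subst (y ∈_) (sym eq) (here refl))
...   | y∈ , y≡ᵇt = subst (_∈ xs) (≡ᵇ⇒≡ y t y≡ᵇt) y∈

parts≤sum : ∀ xs → All (_≤ sum xs) xs
parts≤sum []       = []
parts≤sum (x ∷ xs) = m≤m+n x (sum xs) ∷ All.map (λ y≤ → ≤-trans y≤ (m≤n+m (sum xs) x)) (parts≤sum xs)

length≤sum : ∀ {xs} → Positive xs → length xs ≤ sum xs
length≤sum []           = z≤n
length≤sum (x>0 ∷ xs>0) = +-mono-≤ x>0 (length≤sum xs>0)

*-mult≤sum : ∀ t xs → t * mult xs t ≤ sum xs
*-mult≤sum t []       = ≤-reflexive (*-zeroʳ t)
*-mult≤sum t (x ∷ xs) with x ≟ t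
... | yes refl = subst (_≤ x + sum xs) (sym (trans (cong (x *_) (mult-∷-≡ x xs)) (*-suc x _))) (+-monoʳ-≤ x (*-mult≤sum x xs))
... | no  x≢t  = subst (_≤ x + sum xs) (sym (cong (t *_) (mult-∷-≢ xs x≢t))) (≤-trans (*-mult≤sum t xs) (m≤n+m _ x))

mult≤sum : ∀ {t} xs → 1 ≤ t → mult xs t ≤ sum xs
mult≤sum {t@(suc _)} xs _ = ≤-trans (m≤n*m (mult xs t) t) (*-mult≤sum t xs)

insert-↭ : ∀ x ys → insert x ys ↭ x ∷ ys
insert-↭ x []       = ↭-refl
insert-↭ x (y ∷ ys) with y ≤ᵇ x
... | true  = ↭-refl
... | false = ↭-trans (↭-prep y (insert-↭ x ys)) (↭-swap y x ↭-refl)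

sortDesc-↭ : ∀ xs → sortDesc xs ↭ xs
sortDesc-↭ []       = ↭-refl
sortDesc-↭ (x ∷ xs) = ↭-trans (insert-↭ x (sortDesc xs)) (↭-prep x (sortDesc-↭ xs))

below : ℕ → List ℕ → List ℕ
below u = filterᵇ (_<ᵇ u)

below-∷-< : ∀ {u x} xs → x < u → below u (x ∷ xs) ≡ x ∷ below u xs
below-∷-< {u} {x} xs x<u = filter-accept (T? ∘ (_<ᵇ u)) {x} {xs} (<⇒<ᵇ x<u)

below-∷-≥ : ∀ {u x} xs → u ≤ x → below u (x ∷ xs) ≡ below u xs
below-∷-≥ {u} {x} xs u≤x = filter-reject (T? ∘ (_<ᵇ u)) {x} {xs} (λ x<ᵇu → <⇒≱ (<ᵇ⇒< x u x<ᵇu) u≤x)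

below-all : ∀ {u xs} → All (_< u) xs → below u xs ≡ xs
below-all {u} = filter-all (T? ∘ (_<ᵇ u)) ∘ All.map <⇒<ᵇ

below-zero : ∀ xs → below 0 xs ≡ []
below-zero xs = filter-none (T? ∘ (_<ᵇ 0)) (All.universal (λ _ ()) xs)

below-suc-↭ : ∀ t xs → below (suc t) xs ↭ replicate (mult xs t) t ++ below t xs
below-suc-↭ t [] = ↭-refl
below-suc-↭ t (x ∷ xs) with <-cmp x t
... | tri< x<t _ _ = begin
  below (suc t) (x ∷ xs)                   ≡⟨ below-∷-< xs (m<n⇒m<1+n x<t) ⟩
  x ∷ below (suc t) xs                     <⟨ below-suc-↭ t xs ⟩
  x ∷ (replicate (mult xs t) t ++ below t xs) ↭⟨ shift x (replicate (mult xs t) t) (below t xs) ⟨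
  replicate (mult xs t) t ++ x ∷ below t xs  ≡⟨ cong₂ (λ m ys → replicate m t ++ ys) (mult-∷-≢ xs (<⇒≢ x<t)) (below-∷-< xs x<t) ⟨
  replicate (mult (x ∷ xs) t) t ++ below t (x ∷ xs) ∎
  where open PermutationReasoning
... | tri≈ _ refl _ = begin
  below (suc x) (x ∷ xs)                   ≡⟨ below-∷-< xs ≤-refl ⟩
  x ∷ below (suc x) xs                     <⟨ below-suc-↭ x xs ⟩
  x ∷ (replicate (mult xs x) x ++ below x xs) ≡⟨ cong₂ (λ m ys → replicate m x ++ ys) (mult-∷-≡ x xs) (below-∷-≥ {x} xs ≤-refl) ⟨
  replicate (mult (x ∷ xs) x) x ++ below x (x ∷ xs) ∎
  where open PermutationReasoning
... | tri> _ _ t<x = begin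
  below (suc t) (x ∷ xs)                   ≡⟨ below-∷-≥ xs t<x ⟩
  below (suc t) xs                         ↭⟨ below-suc-↭ t xs ⟩
  replicate (mult xs t) t ++ below t xs    ≡⟨ cong₂ (λ m ys → replicate m t ++ ys) (mult-∷-≢ xs (>⇒≢ t<x)) (below-∷-≥ xs (<⇒≤ t<x)) ⟨
  replicate (mult (x ∷ xs) t) t ++ below t (x ∷ xs) ∎
  where open PermutationReasoning

Decreasing : List ℕ → Set
Decreasing = AllPairs _≥_

↘↭↘⇒≡ : ∀ {xs ys} → Decreasing xs → Decreasing ys → xs ↭ ys → xs ≡ ys
↘↭↘⇒≡ xs↘ ys↘ xs↭ys =
  Pointwise-≡⇒≡ (↗↭↗⇒≋ ≥-totalOrder (AllPairs⇒Linked xs↘) (AllPairs⇒Linked ys↘) (↭⇒↭ₛ xs↭ys))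

below-suc-≡ : ∀ {t xs ys} → Decreasing xs → Decreasing ys →
  mult xs t ≡ mult ys t → below t xs ≡ below t ys → below (suc t) xs ≡ below (suc t) ys
below-suc-≡ {t} {xs} {ys} xs↘ ys↘ mult≡ below≡ = ↘↭↘⇒≡ (AllPairs.filter⁺ _ xs↘) (AllPairs.filter⁺ _ ys↘) (begin
  below (suc t) xs                      ↭⟨ below-suc-↭ t xs ⟩
  replicate (mult xs t) t ++ below t xs ≡⟨ cong₂ (λ m zs → replicate m t ++ zs) mult≡ below≡ ⟩
  replicate (mult ys t) t ++ below t ys ↭⟨ below-suc-↭ t ys ⟨
  below (suc t) ys ∎)
  where open PermutationReasoning

insert-decreasing : ∀ x {ys} → Decreasing ys → Decreasing (insert x ys)
insert-decreasing x []                      = [] ∷ []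
insert-decreasing x {y ∷ ys} (ys≤y ∷ ys↘) with y ≤ᵇ x in y≤ᵇx
... | true  = (y≤x ∷ All.map (λ z≤y → ≤-trans z≤y y≤x) ys≤y) ∷ ys≤y ∷ ys↘
  where
  y≤x : y ≤ x
  y≤x = ≤ᵇ⇒≤ y x (subst T (sym y≤ᵇx) _)
... | false = All-resp-↭ (↭-sym (insert-↭ x ys)) (<⇒≤ (≰ᵇ⇒> y≤ᵇx) ∷ ys≤y) ∷ insert-decreasing x ys↘

sortDesc-decreasing : ∀ xs → Decreasing (sortDesc xs)
sortDesc-decreasing []       = []
sortDesc-decreasing (x ∷ xs) = insert-decreasing x (sortDesc-decreasing xs)

insert-injective : ∀ x {ys zs} → insert x ys ≡ insert x zs → ys ≡ zs
insert-injective x {[]}     {[]}     _  = refl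
insert-injective x {[]}     {z ∷ zs} eq = ⊥-elim (0≢1+n (suc-injective (trans (cong length eq) (↭-length (insert-↭ x (z ∷ zs))))))
insert-injective x {y ∷ ys} {[]}     eq = ⊥-elim (0≢1+n (suc-injective (trans (sym (cong length eq)) (↭-length (insert-↭ x (y ∷ ys))))))
insert-injective x {y ∷ ys} {z ∷ zs} eq with y ≤ᵇ x in y≤ᵇx | z ≤ᵇ x in z≤ᵇx
... | true  | true  = ∷-injectiveʳ eq
... | false | false = cong₂ _∷_ (∷-injectiveˡ eq) (insert-injective x (∷-injectiveʳ eq))
... | true  | false = ⊥-elim (subst T z≤ᵇx (≤⇒≤ᵇ (≤-reflexive (sym (∷-injectiveˡ eq)))))
... | false | true  = ⊥-elim (subst T y≤ᵇx (≤⇒≤ᵇ (≤-reflexive (∷-injectiveˡ eq))))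

insert-surjective : ∀ {t ys} → Decreasing ys → t ∈ ys → ∃ λ xs → Decreasing xs × insert t xs ≡ ys
insert-surjective {t} ys↘ t∈ys with ∈-∃++ t∈ys
... | as , bs , refl = sortDesc (as ++ bs) , sortDesc-decreasing (as ++ bs) ,
  ↘↭↘⇒≡ (insert-decreasing t (sortDesc-decreasing (as ++ bs))) ys↘ (begin
    insert t (sortDesc (as ++ bs)) ↭⟨ insert-↭ t (sortDesc (as ++ bs)) ⟩
    t ∷ sortDesc (as ++ bs)        <⟨ sortDesc-↭ (as ++ bs) ⟩
    t ∷ as ++ bs                   ↭⟨ shift t as bs ⟨
    as ++ t ∷ bs ∎)
  where open PermutationReasoning

-- #products k xs c x counts the k-element index subsets s of xs with c * product s ≡ x; c accumulates the product
-- of the parts chosen so far.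
#products : ℕ → List ℕ → ℕ → ℕ → ℕ
#products zero    xs       c x = 𝟙 (c ≡ᵇ x)
#products (suc k) []       c x = 0
#products (suc k) (y ∷ ys) c x = #products k ys (c * y) x + #products (suc k) ys c x

mult-map-choose : ∀ k xs c x → mult (map (λ s → c * product s) (choose k xs)) x ≡ #products k xs c x
mult-map-choose zero    xs       c x = trans (mult-singleton (c * 1)) (cong (λ c′ → 𝟙 (c′ ≡ᵇ x)) (*-identityʳ c))
mult-map-choose (suc k) []       c x = refl
mult-map-choose (suc k) (y ∷ ys) c x = begin
  mult (map f (map (y ∷_) (choose k ys) ++ choose (suc k) ys)) x
    ≡⟨ cong (λ zs → mult zs x) (map-++ f (map (y ∷_) (choose k ys)) (choose (suc k) ys)) ⟩
  mult (map f (map (y ∷_) (choose k ys)) ++ map f (choose (suc k) ys)) x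
    ≡⟨ mult-++ (map f (map (y ∷_) (choose k ys))) _ x ⟩
  mult (map f (map (y ∷_) (choose k ys))) x + mult (map f (choose (suc k) ys)) x
    ≡⟨ cong (λ zs → mult zs x + mult (map f (choose (suc k) ys)) x)
            (trans (sym (map-∘ (choose k ys))) (map-cong (λ s → sym (*-assoc c y (product s))) (choose k ys))) ⟩
  mult (map (λ s → (c * y) * product s) (choose k ys)) x + mult (map f (choose (suc k) ys)) x
    ≡⟨ cong₂ _+_ (mult-map-choose k ys (c * y) x) (mult-map-choose (suc k) ys c x) ⟩
  #products k ys (c * y) x + #products (suc k) ys c x ∎
  where
  open ≡-Reasoning
  f : List ℕ → ℕ
  f s = c * product s

mult-pre : ∀ k xs x → mult (pre k xs) x ≡ #products k xs 1 x
mult-pre k xs x = begin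
  mult (sortDesc (map product (choose k xs))) x ≡⟨ mult-↭ x (sortDesc-↭ (map product (choose k xs))) ⟩
  mult (map product (choose k xs)) x            ≡⟨ cong (λ zs → mult zs x) (map-cong (sym ∘ *-identityˡ ∘ product) (choose k xs)) ⟩
  mult (map (λ s → 1 * product s) (choose k xs)) x ≡⟨ mult-map-choose k xs 1 x ⟩
  #products k xs 1 x ∎
  where open ≡-Reasoning

#products-short : ∀ k xs c x → length xs < k → #products k xs c x ≡ 0
#products-short (suc k) []       c x _       = refl
#products-short (suc k) (y ∷ ys) c x (s≤s h) =
  cong₂ _+_ (#products-short k ys (c * y) x h) (#products-short (suc k) ys c x (m<n⇒m<1+n h))

#products-< : ∀ k {xs} c {x} → Positive xs → x < c → #products k xs c x ≡ 0
#products-< zero    c _ x<c  = 𝟙-≡ᵇ-≢ (>⇒≢ x<c)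
#products-< (suc k) c [] x<c = refl
#products-< (suc k) {suc y ∷ ys} c (_ ∷ ys>0) x<c =
  cong₂ _+_ (#products-< k (c * suc y) ys>0 (<-≤-trans x<c (m≤m*n c (suc y)))) (#products-< (suc k) c ys>0 x<c)

#products-ones : ∀ k {xs} c → 1 ≤ c → Positive xs → #products k xs c c ≡ mult xs 1 C k
#products-ones zero    c _   _  = 𝟙-≡ᵇ-refl c
#products-ones (suc k) c _   [] = refl
#products-ones (suc k) {suc zero ∷ ys} c c>0 (_ ∷ ys>0) = begin
  #products k ys (c * 1) c + #products (suc k) ys c c ≡⟨ cong₂ _+_ (cong (λ c′ → #products k ys c′ c) (*-identityʳ c)) refl ⟩
  #products k ys c c + #products (suc k) ys c c       ≡⟨ cong₂ _+_ (#products-ones k c c>0 ys>0) (#products-ones (suc k) c c>0 ys>0) ⟩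
  mult ys 1 C k + mult ys 1 C suc k                   ≡⟨ nCk+nC[k+1]≡[n+1]C[k+1] (mult ys 1) k ⟩
  suc (mult ys 1) C suc k ∎
  where open ≡-Reasoning
#products-ones (suc k) {suc (suc y) ∷ ys} c@(suc _) c>0 (_ ∷ ys>0) =
  cong₂ _+_ (#products-< k (c * suc (suc y)) ys>0 (m<m*n c (suc (suc y)) (s≤s (s≤s z≤n)))) (#products-ones (suc k) c c>0 ys>0)

#products-prime : ∀ k {xs} c {p} → Prime p → ¬ p ∣ c → All (λ y → ¬ p ∣ y) xs → #products k xs c p ≡ 0
#products-prime zero    c {p} p-prime p∤c _  = 𝟙-≡ᵇ-≢ {c} {p} λ { refl → p∤c ∣-refl }
#products-prime (suc k) c p-prime p∤c [] = refl
#products-prime (suc k) {y ∷ ys} c p-prime p∤c (p∤y ∷ p∤ys) =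
  cong₂ _+_ (#products-prime k (c * y) p-prime p∤cy p∤ys) (#products-prime (suc k) c p-prime p∤c p∤ys)
  where
  p∤cy : ¬ _ ∣ c * y
  p∤cy p∣cy with euclidsLemma c y p-prime p∣cy
  ... | inj₁ p∣c = p∤c p∣c
  ... | inj₂ p∣y = p∤y p∣y

#products-drop-large : ∀ k {xs} c {x} u → Positive xs → x < c * u → #products k (below u xs) c x ≡ #products k xs c x
#products-drop-large zero    c u _ _ = refl
#products-drop-large (suc k) {[]} c u _ _ = refl
#products-drop-large (suc k) {suc y ∷ ys} c {x} u (_ ∷ ys>0) x<cu with suc y <ᵇ u in y<ᵇu
... | true  = cong₂ _+_ (#products-drop-large k (c * suc y) u ys>0 (<-≤-trans x<cu (*-monoˡ-≤ u (m≤m*n c (suc y)))))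
                        (#products-drop-large (suc k) c u ys>0 x<cu)
... | false = begin
  #products (suc k) (below u ys) c x                         ≡⟨ #products-drop-large (suc k) c u ys>0 x<cu ⟩
  #products (suc k) ys c x                                   ≡⟨ cong (_+ #products (suc k) ys c x) (#products-< k (c * suc y) ys>0 x<cy) ⟨
  #products k ys (c * suc y) x + #products (suc k) ys c x ∎
  where
  open ≡-Reasoning
  x<cy : x < c * suc y
  x<cy = <-≤-trans x<cu (*-monoʳ-≤ c (≮ᵇ⇒≥ y<ᵇu))

-- A (j+1)-subset with product u ≥ 2 either uses only parts below u, or is one part u together with j ones.
#products-split : ∀ j {u} xs → 1 < u → Positive xs →
  #products (suc j) xs 1 u ≡ mult xs u * (mult xs 1 C j) + #products (suc j) (below u xs) 1 u
#products-split j [] _ _ = refl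
#products-split zero    (suc zero ∷ ys) u>1@(s≤s (s≤s z≤n)) (_ ∷ ys>0) = #products-split zero ys u>1 ys>0
#products-split (suc j) {u} (suc zero ∷ ys) u>1@(s≤s (s≤s z≤n)) (_ ∷ ys>0) = begin
  #products (suc j) ys 1 u + #products (suc (suc j)) ys 1 u
    ≡⟨ cong₂ _+_ (#products-split j ys u>1 ys>0) (#products-split (suc j) ys u>1 ys>0) ⟩
  (m * (m₁ C j) + #products (suc j) B 1 u) + (m * (m₁ C suc j) + #products (suc (suc j)) B 1 u)
    ≡⟨ +-Semigroup.interchange (m * (m₁ C j)) (#products (suc j) B 1 u) (m * (m₁ C suc j)) _ ⟩
  (m * (m₁ C j) + m * (m₁ C suc j)) + #products (suc (suc j)) (1 ∷ B) 1 u
    ≡⟨ cong (_+ #products (suc (suc j)) (1 ∷ B) 1 u) (trans (cong (m *_) (sym (nCk+nC[k+1]≡[n+1]C[k+1] m₁ j))) (*-distribˡ-+ m _ _)) ⟨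
  m * (suc m₁ C suc j) + #products (suc (suc j)) (1 ∷ B) 1 u ∎
  where
  open ≡-Reasoning
  m m₁ : ℕ
  m = mult ys u
  m₁ = mult ys 1
  B : List ℕ
  B = below u ys
#products-split j {u} (y@(suc (suc _)) ∷ ys) u>1@(s≤s (s≤s z≤n)) (_ ∷ ys>0) with <-cmp y u
... | tri< y<u _ _ = begin
  #products j ys (1 * y) u + #products (suc j) ys 1 u
    ≡⟨ cong₂ _+_ (sym (#products-drop-large j (1 * y) u ys>0 u<yu)) (#products-split j ys u>1 ys>0) ⟩
  #products j B (1 * y) u + (m * (m₁ C j) + #products (suc j) B 1 u)
    ≡⟨ +-Semigroup.x∙yz≈y∙xz (#products j B (1 * y) u) (m * (m₁ C j)) (#products (suc j) B 1 u) ⟩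
  m * (m₁ C j) + #products (suc j) (y ∷ B) 1 u
    ≡⟨ cong₂ (λ m′ zs → m′ * (m₁ C j) + #products (suc j) zs 1 u) (mult-∷-≢ ys (<⇒≢ y<u)) (below-∷-< ys y<u) ⟨
  mult (y ∷ ys) u * (m₁ C j) + #products (suc j) (below u (y ∷ ys)) 1 u ∎
  where
  open ≡-Reasoning
  m m₁ : ℕ
  m = mult ys u
  m₁ = mult ys 1
  B : List ℕ
  B = below u ys
  u<yu : u < 1 * y * u
  u<yu = subst (u <_) (trans (*-comm u y) (cong (_* u) (sym (*-identityˡ y)))) (m<m*n u y (s≤s (s≤s z≤n)))
... | tri≈ _ refl _ = begin
  #products j ys (1 * u) u + #products (suc j) ys 1 u
    ≡⟨ cong₂ _+_ (trans (cong (λ c → #products j ys c u) (*-identityˡ u)) (#products-ones j u (s≤s z≤n) ys>0))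
                 (#products-split j ys u>1 ys>0) ⟩
  m₁ C j + (m * (m₁ C j) + #products (suc j) B 1 u)
    ≡⟨ +-assoc (m₁ C j) _ _ ⟨
  suc m * (m₁ C j) + #products (suc j) B 1 u
    ≡⟨ cong₂ (λ m′ zs → m′ * (m₁ C j) + #products (suc j) zs 1 u) (mult-∷-≡ u ys) (below-∷-≥ {u} ys ≤-refl) ⟨
  mult (u ∷ ys) u * (m₁ C j) + #products (suc j) (below u (u ∷ ys)) 1 u ∎
  where
  open ≡-Reasoning
  m m₁ : ℕ
  m = mult ys u
  m₁ = mult ys 1
  B : List ℕ
  B = below u ys
... | tri> _ _ u<y = begin
  #products j ys (1 * y) u + #products (suc j) ys 1 u
    ≡⟨ cong (_+ #products (suc j) ys 1 u) (#products-< j (1 * y) ys>0 (subst (u <_) (sym (*-identityˡ y)) u<y)) ⟩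
  #products (suc j) ys 1 u
    ≡⟨ #products-split j ys u>1 ys>0 ⟩
  mult ys u * (mult ys 1 C j) + #products (suc j) (below u ys) 1 u
    ≡⟨ cong₂ (λ m′ zs → m′ * (mult ys 1 C j) + #products (suc j) zs 1 u)
             (mult-∷-≢ ys (>⇒≢ u<y)) (below-∷-≥ ys (<⇒≤ u<y)) ⟨
  mult (y ∷ ys) u * (mult ys 1 C j) + #products (suc j) (below u (y ∷ ys)) 1 u ∎
  where open ≡-Reasoning

mult-pre-1 : ∀ k {xs} → Positive xs → mult (pre k xs) 1 ≡ mult xs 1 C k
mult-pre-1 k {xs} xs>0 = trans (mult-pre k xs 1) (#products-ones k 1 (s≤s z≤n) xs>0)

-- No product of parts below p equals p, as none of them is divisible by p.
mult-pre-prime : ∀ j {xs p} → Prime p → Positive xs → mult (pre (suc j) xs) p ≡ mult xs p * (mult xs 1 C j)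
mult-pre-prime j {xs} {p} p-prime xs>0 = begin
  mult (pre (suc j) xs) p                                            ≡⟨ mult-pre (suc j) xs p ⟩
  #products (suc j) xs 1 p                                           ≡⟨ #products-split j xs (prime⇒>1 p-prime) xs>0 ⟩
  mult xs p * (mult xs 1 C j) + #products (suc j) (below p xs) 1 p    ≡⟨ cong (mult xs p * (mult xs 1 C j) +_) no-small-factors ⟩
  mult xs p * (mult xs 1 C j) + 0                                    ≡⟨ +-identityʳ _ ⟩
  mult xs p * (mult xs 1 C j) ∎
  where
  open ≡-Reasoning
  p∤ : ∀ {y} → 1 ≤ y → T (y <ᵇ p) → ¬ p ∣ y
  p∤ {y} y>0 y<ᵇp p∣y = <⇒≱ (<ᵇ⇒< y p y<ᵇp) (∣⇒≤ {{>-nonZero y>0}} p∣y)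
  no-small-factors : #products (suc j) (below p xs) 1 p ≡ 0
  no-small-factors = #products-prime (suc j) 1 p-prime (p∤ ≤-refl (<⇒<ᵇ (prime⇒>1 p-prime)))
    (All.zipWith (λ (y>0 , y<p) → p∤ y>0 y<p) (All.filter⁺ (T? ∘ (_<ᵇ p)) xs>0 , All.all-filter (T? ∘ (_<ᵇ p)) xs))

-- With at least j ones, pre_{j+1} λ determines λ: the multiplicity of 1 in it determines m₁ (C(·, j+1) is injective
-- above j), and by #products-split the parts of λ below u together with the multiplicity of u in it determine m_u.
pre-injective : ∀ j {xs ys} → Decreasing xs → Decreasing ys → Positive xs → Positive ys →
  j ≤ mult xs 1 → j ≤ mult ys 1 → (∀ x → mult (pre (suc j) xs) x ≡ mult (pre (suc j) ys) x) → xs ≡ ys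
pre-injective j {xs} {ys} xs↘ ys↘ xs>0 ys>0 j≤xs₁ j≤ys₁ same = begin
  xs         ≡⟨ below-all (bounded xs (m≤m+n _ _)) ⟨
  below N xs ≡⟨ below-same N ⟩
  below N ys ≡⟨ below-all (bounded ys (m≤n+m _ _)) ⟩
  ys ∎
  where
  open ≡-Reasoning
  N : ℕ
  N = suc (sum xs + sum ys)
  bounded : ∀ zs → sum zs ≤ sum xs + sum ys → All (_< N) zs
  bounded zs zs≤ = All.map (λ z≤ → s≤s (≤-trans z≤ zs≤)) (parts≤sum zs)
  #same : ∀ x → #products (suc j) xs 1 x ≡ #products (suc j) ys 1 x
  #same x = trans (sym (mult-pre (suc j) xs x)) (trans (same x) (mult-pre (suc j) ys x))
  ones : mult xs 1 ≡ mult ys 1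
  ones = C-injectiveˡ j≤xs₁ j≤ys₁
    (trans (sym (#products-ones (suc j) 1 (s≤s z≤n) xs>0)) (trans (#same 1) (#products-ones (suc j) 1 (s≤s z≤n) ys>0)))
  mult-same : ∀ u → below u xs ≡ below u ys → mult xs u ≡ mult ys u
  mult-same zero          _      = trans (mult-zero xs>0) (sym (mult-zero ys>0))
  mult-same (suc zero)    _      = ones
  mult-same u@(suc (suc _)) below≡ =
    *-cancelʳ-≡ (mult xs u) (mult ys u) (mult xs 1 C j) {{>-nonZero (≤⇒C>0 j≤xs₁)}} (+-cancelʳ-≡ _ _ _ (begin
      mult xs u * (mult xs 1 C j) + #products (suc j) (below u xs) 1 u ≡⟨ #products-split j xs (s≤s (s≤s z≤n)) xs>0 ⟨
      #products (suc j) xs 1 u                                         ≡⟨ #same u ⟩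
      #products (suc j) ys 1 u                                         ≡⟨ #products-split j ys (s≤s (s≤s z≤n)) ys>0 ⟩
      mult ys u * (mult ys 1 C j) + #products (suc j) (below u ys) 1 u
        ≡⟨ cong₂ (λ m₁ zs → mult ys u * (m₁ C j) + #products (suc j) zs 1 u) ones below≡ ⟨
      mult ys u * (mult xs 1 C j) + #products (suc j) (below u xs) 1 u ∎))
  below-same : ∀ t → below t xs ≡ below t ys
  below-same zero    = trans (below-zero xs) (sym (below-zero ys))
  below-same (suc t) = below-suc-≡ xs↘ ys↘ (mult-same t (below-same t)) (below-same t)

record IsPartition (n : ℕ) (xs : List ℕ) : Set where
  field
    decreasing : Decreasing xs
    positive   : Positive xs
    sum≡       : sum xs ≡ n

decreasingᵇ⇒Linked : ∀ xs → T (decreasingᵇ xs) → Linked _≥_ xs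
decreasingᵇ⇒Linked []           _ = []
decreasingᵇ⇒Linked (x ∷ [])     _ = [-]
decreasingᵇ⇒Linked (x ∷ y ∷ xs) t =
  ≤ᵇ⇒≤ y x (proj₁ (Equivalence.to T-∧ t)) ∷ decreasingᵇ⇒Linked (y ∷ xs) (proj₂ (Equivalence.to T-∧ t))

Linked⇒decreasingᵇ : ∀ {xs} → Linked _≥_ xs → T (decreasingᵇ xs)
Linked⇒decreasingᵇ []           = _
Linked⇒decreasingᵇ [-]          = _
Linked⇒decreasingᵇ (y≤x ∷ rest) = Equivalence.from T-∧ (≤⇒≤ᵇ y≤x , Linked⇒decreasingᵇ rest)

positiveᵇ⇒Positive : ∀ xs → T (positiveᵇ xs) → Positive xs
positiveᵇ⇒Positive []       _ = []
positiveᵇ⇒Positive (x ∷ xs) t =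
  ≤ᵇ⇒≤ 1 x (proj₁ (Equivalence.to T-∧ t)) ∷ positiveᵇ⇒Positive xs (proj₂ (Equivalence.to T-∧ t))

Positive⇒positiveᵇ : ∀ {xs} → Positive xs → T (positiveᵇ xs)
Positive⇒positiveᵇ []           = _
Positive⇒positiveᵇ (x>0 ∷ rest) = Equivalence.from T-∧ (≤⇒≤ᵇ x>0 , Positive⇒positiveᵇ rest)

isPartitionᵇ⇒IsPartition : ∀ {n} xs → T (isPartitionᵇ n xs) → IsPartition n xs
isPartitionᵇ⇒IsPartition {n} xs t with Equivalence.to T-∧ t
... | t↘ , t′ with Equivalence.to T-∧ t′
... | t>0 , t≡ = record
  { decreasing = Linked⇒AllPairs (λ y≤x z≤y → ≤-trans z≤y y≤x) (decreasingᵇ⇒Linked xs t↘)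
  ; positive   = positiveᵇ⇒Positive xs t>0
  ; sum≡       = ≡ᵇ⇒≡ (sum xs) n t≡
  }

IsPartition⇒isPartitionᵇ : ∀ {n xs} → IsPartition n xs → T (isPartitionᵇ n xs)
IsPartition⇒isPartitionᵇ {n} {xs} xs⊢n = Equivalence.from T-∧
  (Linked⇒decreasingᵇ (AllPairs⇒Linked decreasing) , Equivalence.from T-∧ (Positive⇒positiveᵇ positive , ≡⇒≡ᵇ (sum xs) n sum≡))
  where open IsPartition xs⊢n

words-cartesian : ∀ m l → words m (suc l) ≡ cartesianProductWith _∷_ (applyUpTo (λ i → i) (suc m)) (words m l)
words-cartesian m l = go (applyUpTo (λ i → i) (suc m))
  where
  go : ∀ hs → concatMap (λ x → map (x ∷_) (words m l)) hs ≡ cartesianProductWith _∷_ hs (words m l)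
  go []       = refl
  go (h ∷ hs) = cong (map (h ∷_) (words m l) ++_) (go hs)

words-unique : ∀ m l → Unique (words m l)
words-unique m zero    = [] ∷ []
words-unique m (suc l) = subst Unique (sym (words-cartesian m l))
  (Unique.cartesianProductWith⁺ _∷_ ∷-injective (Unique.upTo⁺ (suc m)) (words-unique m l))

∈-words⁻ : ∀ m l {v} → v ∈ words m l → length v ≡ l
∈-words⁻ m zero    (here refl) = refl
∈-words⁻ m (suc l) v∈
  with ∈-cartesianProductWith⁻ _∷_ (applyUpTo (λ i → i) (suc m)) (words m l) (subst (_ ∈_) (words-cartesian m l) v∈)
... | _ , w , _ , w∈ , refl = cong suc (∈-words⁻ m l w∈)

∈-words⁺ : ∀ m {v} → All (_≤ m) v → v ∈ words m (length v)
∈-words⁺ m []           = here refl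
∈-words⁺ m {x ∷ v} (x≤m ∷ v≤m) = subst (x ∷ v ∈_) (sym (words-cartesian m (length v)))
  (∈-cartesianProductWith⁺ _∷_ (∈-applyUpTo⁺ (λ i → i) (s≤s x≤m)) (∈-words⁺ m v≤m))

∈-wordsUpTo⁻ : ∀ m l {v} → v ∈ wordsUpTo m l → length v ≤ l
∈-wordsUpTo⁻ m zero    v∈ = ≤-reflexive (∈-words⁻ m zero v∈)
∈-wordsUpTo⁻ m (suc l) v∈ with ∈-++⁻ (wordsUpTo m l) v∈
... | inj₁ v∈′ = m≤n⇒m≤1+n (∈-wordsUpTo⁻ m l v∈′)
... | inj₂ v∈′ = ≤-reflexive (∈-words⁻ m (suc l) v∈′)

∈-wordsUpTo⁺ : ∀ m l {v} → length v ≤ l → All (_≤ m) v → v ∈ wordsUpTo m l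
∈-wordsUpTo⁺ m zero    {[]} _ [] = here refl
∈-wordsUpTo⁺ m (suc l) {v} |v|≤ v≤m with m≤n⇒m<n∨m≡n |v|≤
... | inj₁ (s≤s |v|≤l) = ∈-++⁺ˡ (∈-wordsUpTo⁺ m l |v|≤l v≤m)
... | inj₂ |v|≡        = ∈-++⁺ʳ (wordsUpTo m l) (subst (λ l′ → v ∈ words m l′) |v|≡ (∈-words⁺ m v≤m))

wordsUpTo-unique : ∀ m l → Unique (wordsUpTo m l)
wordsUpTo-unique m zero    = words-unique m zero
wordsUpTo-unique m (suc l) = Unique.++⁺ (wordsUpTo-unique m l) (words-unique m (suc l))
  λ (v∈ , v∈′) → <-irrefl (∈-words⁻ m (suc l) v∈′) (s≤s (∈-wordsUpTo⁻ m l v∈))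

𝒫-unique : ∀ n → Unique (𝒫 n)
𝒫-unique n = Unique.filter⁺ _ (wordsUpTo-unique n n)

∈-𝒫⁻ : ∀ {n xs} → xs ∈ 𝒫 n → IsPartition n xs
∈-𝒫⁻ {n} {xs} xs∈ = isPartitionᵇ⇒IsPartition xs (proj₂ (∈-filter⁻ (T? ∘ isPartitionᵇ n) {xs = wordsUpTo n n} xs∈))

∈-𝒫⁺ : ∀ {n xs} → IsPartition n xs → xs ∈ 𝒫 n
∈-𝒫⁺ {n} {xs} xs⊢n = ∈-filter⁺ (T? ∘ isPartitionᵇ n)
  (∈-wordsUpTo⁺ n n (subst (length xs ≤_) sum≡ (length≤sum positive)) (subst (λ s → All (_≤ s) xs) sum≡ (parts≤sum xs)))
  (IsPartition⇒isPartitionᵇ xs⊢n)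
  where open IsPartition xs⊢n

#𝒫 : (List ℕ → Bool) → ℕ → ℕ
#𝒫 q n = length (filterᵇ q (𝒫 n))

#𝒫-≡0 : ∀ {q} n t c → (∀ xs → T (q xs) → c ≤ mult xs t) → n < t * c → #𝒫 q n ≡ 0
#𝒫-≡0 {q} n t c q⇒c≤ n<tc = cong length (filter-none (T? ∘ q) (All.tabulate λ {xs} xs∈ qxs →
  <⇒≱ n<tc (≤-trans (*-monoʳ-≤ t (q⇒c≤ xs qxs))
                    (subst (t * mult xs t ≤_) (IsPartition.sum≡ (∈-𝒫⁻ xs∈)) (*-mult≤sum t xs)))))

-- Inserting a part t maps the partitions of n bijectively onto the partitions of t + n having a part t.
#𝒫-insert : ∀ {t} (q q′ : List ℕ → Bool) n → 1 ≤ t →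
  (∀ xs → q (insert t xs) ≡ q′ xs) → (∀ xs → T (q xs) → 1 ≤ mult xs t) → #𝒫 q (t + n) ≡ #𝒫 q′ n
#𝒫-insert {t} q q′ n t>0 q∘insert q⇒t∈ = sym (length-bijection (insert t)
  (Unique.filter⁺ _ (𝒫-unique n)) (Unique.filter⁺ _ (𝒫-unique (t + n))) (insert-injective t) to from)
  where
  to : ∀ {xs} → xs ∈ filterᵇ q′ (𝒫 n) → insert t xs ∈ filterᵇ q (𝒫 (t + n))
  to {xs} xs∈ with ∈-filter⁻ (T? ∘ q′) {xs = 𝒫 n} xs∈
  ... | xs∈𝒫 , q′xs = ∈-filter⁺ (T? ∘ q) (∈-𝒫⁺ record
      { decreasing = insert-decreasing t decreasing
      ; positive   = All-resp-↭ (↭-sym (insert-↭ t xs)) (t>0 ∷ positive)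
      ; sum≡       = trans (sum-↭ (insert-↭ t xs)) (cong (t +_) sum≡)
      }) (subst T (sym (q∘insert xs)) q′xs)
    where open IsPartition (∈-𝒫⁻ {n} xs∈𝒫)
  from : ∀ {ys} → ys ∈ filterᵇ q (𝒫 (t + n)) → ∃ λ xs → xs ∈ filterᵇ q′ (𝒫 n) × insert t xs ≡ ys
  from {ys} ys∈ with ∈-filter⁻ (T? ∘ q) {xs = 𝒫 (t + n)} ys∈
  ... | ys∈𝒫 , qys with insert-surjective decreasing (mult>0⇒∈ ys (q⇒t∈ ys qys))
    where open IsPartition (∈-𝒫⁻ {t + n} ys∈𝒫)
  ... | xs , xs↘ , refl = xs , ∈-filter⁺ (T? ∘ q′) (∈-𝒫⁺ record
      { decreasing = xs↘
      ; positive   = All.tail (All-resp-↭ (insert-↭ t xs) positive)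
      ; sum≡       = +-cancelˡ-≡ t _ _ (trans (sym (sum-↭ (insert-↭ t xs))) sum≡)
      }) (subst T (q∘insert xs) qys) , refl
    where open IsPartition (∈-𝒫⁻ {t + n} ys∈𝒫)

𝔭-suc : ∀ n m → 𝔭- (suc n) (suc m) ≡ 𝔭- n m
𝔭-suc n m rewrite ≤ᵇ-suc m n = refl

𝔭-+ : ∀ t n m → 𝔭- (t + n) (t + m) ≡ 𝔭- n m
𝔭-+ zero    n m = refl
𝔭-+ (suc t) n m = trans (𝔭-suc (t + n) (t + m)) (𝔭-+ t n m)

𝔭-≡0 : ∀ {n m} → n < m → 𝔭- n m ≡ 0
𝔭-≡0 {n} {m} n<m with m ≤ᵇ n in m≤ᵇn
... | true  = ⊥-elim (<⇒≱ n<m (≤ᵇ⇒≤ m n (subst T (sym m≤ᵇn) _)))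
... | false = refl

atLeast : ℕ → ℕ → ℕ → List ℕ → Bool
atLeast s i j xs = (j ≤ᵇ mult xs s) ∧ (i ≤ᵇ mult xs 1)

atLeast⇒parts : ∀ {s i j} xs → T (atLeast s i j xs) → j ≤ mult xs s
atLeast⇒parts {s} {i} {j} xs = ≤ᵇ⇒≤ j (mult xs s) ∘ proj₁ ∘ Equivalence.to T-∧

atLeast⇒ones : ∀ {s i j} xs → T (atLeast s i j xs) → i ≤ mult xs 1
atLeast⇒ones {s} {i} {j} xs = ≤ᵇ⇒≤ i (mult xs 1) ∘ proj₂ ∘ Equivalence.to (T-∧ {j ≤ᵇ mult xs s})

#𝒫-atLeast : ∀ {s} → 1 < s → ∀ i j n → #𝒫 (atLeast s i j) n ≡ 𝔭- n (i + s * j)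
#𝒫-atLeast {s} s>1 zero    zero    n = trans (cong length (filter-all _ (All.universal _ (𝒫 n)))) (cong (𝔭- n) (sym (*-zeroʳ s)))
#𝒫-atLeast {s} s>1 zero    (suc j) n with n <? s
... | yes n<s = trans (#𝒫-≡0 n s (suc j) (atLeast⇒parts {s} {0} {suc j}) n<s[1+j]) (sym (𝔭-≡0 n<s[1+j]))
  where
  n<s[1+j] : n < s * suc j
  n<s[1+j] = <-≤-trans n<s (m≤m*n s (suc j))
... | no  n≮s = subst (λ n → #𝒫 (atLeast s 0 (suc j)) n ≡ 𝔭- n (s * suc j)) (m+[n∸m]≡n (≮⇒≥ n≮s)) (begin
  #𝒫 (atLeast s 0 (suc j)) (s + n′) ≡⟨ #𝒫-insert (atLeast s 0 (suc j)) (atLeast s 0 j) n′ (<⇒≤ s>1) insert-s has-s ⟩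
  #𝒫 (atLeast s 0 j) n′             ≡⟨ #𝒫-atLeast s>1 0 j n′ ⟩
  𝔭- n′ (s * j)                      ≡⟨ 𝔭-+ s n′ (s * j) ⟨
  𝔭- (s + n′) (s + s * j)            ≡⟨ cong (𝔭- (s + n′)) (*-suc s j) ⟨
  𝔭- (s + n′) (s * suc j) ∎)
  where
  open ≡-Reasoning
  n′ : ℕ
  n′ = n ∸ s
  has-s : ∀ xs → T (atLeast s 0 (suc j) xs) → 1 ≤ mult xs s
  has-s xs = ≤-trans (s≤s z≤n) ∘ atLeast⇒parts {s} {0} {suc j} xs
  insert-s : ∀ xs → atLeast s 0 (suc j) (insert s xs) ≡ atLeast s 0 j xs
  insert-s xs = cong (_∧ true)
    (trans (cong (suc j ≤ᵇ_) (trans (mult-↭ s (insert-↭ s xs)) (mult-∷-≡ s xs))) (≤ᵇ-suc j (mult xs s)))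
#𝒫-atLeast {s} s>1 (suc i) j zero    = #𝒫-≡0 {atLeast s (suc i) j} 0 1 (suc i) (atLeast⇒ones {s} {suc i} {j}) (s≤s z≤n)
#𝒫-atLeast {s} s>1 (suc i) j (suc n) =
  trans (#𝒫-insert (atLeast s (suc i) j) (atLeast s i j) n ≤-refl insert-1 (λ xs → ≤-trans (s≤s z≤n) ∘ atLeast⇒ones {s} {suc i} {j} xs))
        (trans (#𝒫-atLeast s>1 i j n) (sym (𝔭-suc n (i + s * j))))
  where
  insert-1 : ∀ xs → atLeast s (suc i) j (insert 1 xs) ≡ atLeast s i j xs
  insert-1 xs = cong₂ (λ m b → (j ≤ᵇ m) ∧ b)
    (trans (mult-↭ s (insert-↭ 1 xs)) (mult-∷-≢ xs (<⇒≢ s>1)))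
    (trans (cong (suc i ≤ᵇ_) (mult-↭ 1 (insert-↭ 1 xs))) (≤ᵇ-suc i (mult xs 1)))

-- atLeast 2 i 0 imposes no condition on the parts equal to 2.
#𝒫-ones : ∀ i n → #𝒫 (λ xs → i ≤ᵇ mult xs 1) n ≡ 𝔭- n i
#𝒫-ones i n = trans (#𝒫-atLeast {2} (s≤s (s≤s z≤n)) i 0 n) (cong (𝔭- n) (+-identityʳ i))

-- When the partitions contributing to a_{q,k}(n) have at least k - 1 ones, pre_k is injective on them, so removing
-- duplicates from pre_k(𝒫(n)) loses nothing; partitions with fewer than k parts contribute 0.
a-as-sum : ∀ j {q} n → (∀ {xs} → IsPartition n xs → 0 < mult (pre (suc (suc j)) xs) q → suc j ≤ mult xs 1) →
  a q (suc (suc j)) n ≡ sum (map (λ xs → mult (pre (suc (suc j)) xs) q) (𝒫 n))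
a-as-sum j {q} n has-ones = begin
  sum (map w (deduplicate (≡-dec _≟_) (map (pre K) F)))
    ≡⟨ sum-map-deduplicate (≡-dec _≟_) w (AllPairs.map⁺ (distinct F⊢ (Unique.filter⁺ _ (𝒫-unique n)))) ⟩
  sum (map w (map (pre K) F))  ≡⟨ cong sum (map-∘ F) ⟨
  sum (map (w ∘ pre K) F)      ≡⟨ sum-map-filter (w ∘ pre K) (T? ∘ (λ xs → K ≤ᵇ length xs)) (𝒫 n) short ⟩
  sum (map (w ∘ pre K) (𝒫 n)) ∎
  where
  open ≡-Reasoning
  K : ℕ
  K = suc (suc j)
  w : List ℕ → ℕ
  w ν = mult ν q
  F : List (List ℕ)
  F = filterᵇ (λ xs → K ≤ᵇ length xs) (𝒫 n)
  F⊢ : All (IsPartition n) F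
  F⊢ = All.tabulate (λ xs∈ → ∈-𝒫⁻ (proj₁ (∈-filter⁻ (T? ∘ (λ xs → K ≤ᵇ length xs)) {xs = 𝒫 n} xs∈)))
  injective : ∀ {xs ys} → IsPartition n xs → IsPartition n ys → 0 < w (pre K xs) → pre K xs ≡ pre K ys → xs ≡ ys
  injective xs⊢ ys⊢ w>0 pre≡ = pre-injective (suc j) (decreasing xs⊢) (decreasing ys⊢) (positive xs⊢) (positive ys⊢)
    (has-ones xs⊢ w>0) (has-ones ys⊢ (subst (λ ν → 0 < w ν) pre≡ w>0)) (λ x → cong (λ ν → mult ν x) pre≡)
    where open IsPartition
  distinct : ∀ {ys} → All (IsPartition n) ys → Unique ys → AllPairs (λ a b → 0 < w (pre K a) → pre K a ≢ pre K b) ys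
  distinct []           []            = []
  distinct (a⊢ ∷ ys⊢) (a≢ys ∷ ys!) =
    All.zipWith (λ (b⊢ , a≢b) w>0 → a≢b ∘ injective a⊢ b⊢ w>0) (ys⊢ , a≢ys) ∷ distinct ys⊢ ys!
  short : ∀ {xs} → xs ∈ 𝒫 n → ¬ T (K ≤ᵇ length xs) → w (pre K xs) ≡ 0
  short {xs} _ K≰ = trans (mult-pre K xs q) (#products-short K xs 1 q (≰⇒> (K≰ ∘ ≤⇒≤ᵇ)))

mult-pre-1-as-Σ : ∀ j {n xs} → IsPartition n xs →
  mult (pre (suc (suc j)) xs) 1 ≡ Σ[1‥ n ] (λ i → ((i ∸ 1) C suc j) * 𝟙 (i ≤ᵇ mult xs 1))
mult-pre-1-as-Σ j {n} {xs} xs⊢n =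
  trans (mult-pre-1 (suc (suc j)) positive) (C-as-Σ n (suc j) (subst (mult xs 1 ≤_) sum≡ (mult≤sum xs ≤-refl)))
  where open IsPartition xs⊢n

mult-pre-prime-as-Σ : ∀ j {n p xs} → Prime p → IsPartition n xs →
  mult (pre (suc (suc j)) xs) p ≡ Σ[1‥ n ] (λ i → Σ[1‥ n ] (λ l → ((i ∸ 1) C j) * 𝟙 (atLeast p i l xs)))
mult-pre-prime-as-Σ j {n} {p} {xs} p-prime xs⊢n = begin
  mult (pre (suc (suc j)) xs) p                                    ≡⟨ mult-pre-prime (suc j) p-prime positive ⟩
  mult xs p * (mult xs 1 C suc j)                                  ≡⟨ *-comm (mult xs p) _ ⟩
  (mult xs 1 C suc j) * mult xs p                                  ≡⟨ cong₂ _*_ (C-as-Σ n j ones≤n) (n-as-Σ n p≤n) ⟩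
  Σ[1‥ n ] (λ i → c i * ones i) * Σ[1‥ n ] ps                      ≡⟨ Σ-* n _ (λ i → c i * ones i) ⟩
  Σ[1‥ n ] (λ i → c i * ones i * Σ[1‥ n ] ps)                      ≡⟨ Σ-cong n (λ {i} _ → *-Σ n (c i * ones i) ps) ⟩
  Σ[1‥ n ] (λ i → Σ[1‥ n ] (λ l → c i * ones i * ps l))            ≡⟨ Σ-cong n (λ {i} _ → Σ-cong n (λ {l} _ → rearrange (c i) (ones i) (ps l))) ⟩
  Σ[1‥ n ] (λ i → Σ[1‥ n ] (λ l → c i * (ps l * ones i)))          ≡⟨ Σ-cong n (λ {i} _ → Σ-cong n (λ {l} _ → cong (c i *_) (𝟙-∧ (l ≤ᵇ mult xs p) (i ≤ᵇ mult xs 1)))) ⟨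
  Σ[1‥ n ] (λ i → Σ[1‥ n ] (λ l → c i * 𝟙 (atLeast p i l xs))) ∎
  where
  open ≡-Reasoning
  open IsPartition xs⊢n
  c ones ps : ℕ → ℕ
  c i = (i ∸ 1) C j
  ones i = 𝟙 (i ≤ᵇ mult xs 1)
  ps l = 𝟙 (l ≤ᵇ mult xs p)
  ones≤n : mult xs 1 ≤ n
  ones≤n = subst (mult xs 1 ≤_) sum≡ (mult≤sum xs ≤-refl)
  p≤n : mult xs p ≤ n
  p≤n = subst (mult xs p ≤_) sum≡ (mult≤sum xs (<⇒≤ (prime⇒>1 p-prime)))
  rearrange : ∀ x y z → x * y * z ≡ x * (z * y)
  rearrange x y z = trans (*-assoc x y z) (cong (x *_) (*-comm y z))

a-one : ∀ j n → a 1 (suc (suc j)) n ≡ Σ[1‥ n ] (λ i → ((i ∸ 1) C suc j) * 𝔭- n i)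
a-one j n = begin
  a 1 (suc (suc j)) n
    ≡⟨ a-as-sum j n (λ xs⊢n w>0 → ≤-trans (n≤1+n (suc j)) (C>0⇒≤ (subst (0 <_) (mult-pre-1 (suc (suc j)) (IsPartition.positive xs⊢n)) w>0))) ⟩
  sum (map (λ xs → mult (pre (suc (suc j)) xs) 1) (𝒫 n))
    ≡⟨ cong sum (map-cong-local (All.tabulate (mult-pre-1-as-Σ j ∘ ∈-𝒫⁻ {n}))) ⟩
  sum (map (λ xs → Σ[1‥ n ] (λ i → c i * 𝟙 (i ≤ᵇ mult xs 1))) (𝒫 n))
    ≡⟨ sum-map-Σ n (λ xs i → c i * 𝟙 (i ≤ᵇ mult xs 1)) (𝒫 n) ⟩
  Σ[1‥ n ] (λ i → sum (map (λ xs → c i * 𝟙 (i ≤ᵇ mult xs 1)) (𝒫 n)))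
    ≡⟨ Σ-cong n (λ {i} _ → trans (sum-map-𝟙 (c i) (λ xs → i ≤ᵇ mult xs 1) (𝒫 n)) (cong (c i *_) (#𝒫-ones i n))) ⟩
  Σ[1‥ n ] (λ i → c i * 𝔭- n i) ∎
  where
  open ≡-Reasoning
  c : ℕ → ℕ
  c i = (i ∸ 1) C suc j

a-prime : ∀ j n {p} → Prime p → a p (suc (suc j)) n ≡ Σ[1‥ n ] (λ i → Σ[1‥ n ] (λ l → ((i ∸ 1) C j) * 𝔭- n (i + p * l)))
a-prime j n {p} p-prime = begin
  a p (suc (suc j)) n
    ≡⟨ a-as-sum j n (λ xs⊢n w>0 → C>0⇒≤ (C>0 xs⊢n w>0)) ⟩
  sum (map (λ xs → mult (pre (suc (suc j)) xs) p) (𝒫 n))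
    ≡⟨ cong sum (map-cong-local (All.tabulate (mult-pre-prime-as-Σ j p-prime ∘ ∈-𝒫⁻ {n}))) ⟩
  sum (map (λ xs → Σ[1‥ n ] (λ i → Σ[1‥ n ] (λ l → c i * 𝟙 (atLeast p i l xs)))) (𝒫 n))
    ≡⟨ sum-map-Σ n (λ xs i → Σ[1‥ n ] (λ l → c i * 𝟙 (atLeast p i l xs))) (𝒫 n) ⟩
  Σ[1‥ n ] (λ i → sum (map (λ xs → Σ[1‥ n ] (λ l → c i * 𝟙 (atLeast p i l xs))) (𝒫 n)))
    ≡⟨ Σ-cong n (λ {i} _ → sum-map-Σ n (λ xs l → c i * 𝟙 (atLeast p i l xs)) (𝒫 n)) ⟩
  Σ[1‥ n ] (λ i → Σ[1‥ n ] (λ l → sum (map (λ xs → c i * 𝟙 (atLeast p i l xs)) (𝒫 n))))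
    ≡⟨ Σ-cong n (λ {i} _ → Σ-cong n (λ {l} _ → trans (sum-map-𝟙 (c i) (atLeast p i l) (𝒫 n))
                                                       (cong (c i *_) (#𝒫-atLeast (prime⇒>1 p-prime) i l n)))) ⟩
  Σ[1‥ n ] (λ i → Σ[1‥ n ] (λ l → c i * 𝔭- n (i + p * l))) ∎
  where
  open ≡-Reasoning
  c : ℕ → ℕ
  c i = (i ∸ 1) C j
  C>0 : ∀ {xs} → IsPartition n xs → 0 < mult (pre (suc (suc j)) xs) p → 0 < mult xs 1 C suc j
  C>0 {xs} xs⊢n w>0 = >-nonZero⁻¹ _ {{m*n≢0⇒n≢0 (mult xs p) {{>-nonZero mpC>0}}}}
    where
    mpC>0 : 0 < mult xs p * (mult xs 1 C suc j)
    mpC>0 = subst (0 <_) (mult-pre-prime (suc j) p-prime (IsPartition.positive xs⊢n)) w>0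

theorem3p3 : (k n p : ℕ) → 2 ≤ k → Prime p →
    (a 1 k n ≡ Σ[1‥ n ] (λ i → ((i ∸ 1) C (k ∸ 1)) * 𝔭- n i))
    × (a p k n ≡ Σ[1‥ n ] (λ i → Σ[1‥ n ] (λ j → ((i ∸ 1) C (k ∸ 2)) * 𝔭- n (i + p * j))))
theorem3p3 (suc (suc j)) n p (s≤s (s≤s z≤n)) p-prime = a-one j n , a-prime j n p-prime
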